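{- Let $(A,X,I)$ be a formal context, $R_s,R_t\subseteq A\times X$ $I$-compatible, and $Y\subseteq X$ Galois-stable. Then $R_{st}^\downarrow[Y]=R_s^\downarrow[I^\uparrow[R_t^\downarrow[Y]]]$, where $R_{st}$ is the $I$-product of $R_s$ and $R_t$.
   Context: For $S\subseteq A\times X$, $B\subseteq A$, $Y\subseteq X$: $S^\uparrow[B]=\{x\mid\forall a\in B,\ aSx\}$, $S^\downarrow[Y]=\{a\mid\forall x\in Y,\ aSx\}$, $S^\uparrow[a]=S^\uparrow[\{a\}]$, $S^\downarrow[x]=S^\downarrow[\{x\}]$, $B^\uparrow=I^\uparrow[B]$, $Y^\downarrow=I^\downarrow[Y]$, $x^{\downarrow\uparrow}=\{x\}^{\downarrow\uparrow}$. Galois-stable: $B=B^{\uparrow\downarrow}$, $Y=Y^{\downarrow\uparrow}$. $R$ is $I$-compatible if $R^\downarrow[x]$ and $R^\uparrow[a]$ are Galois-stable for all $x,a$. The $I$-product of $R_s,R_t$ is $R_{st}\subseteq A\times X$ with $aR_{st}x$ iff $a\in R_s^\downarrow[I^\uparrow[R_t^\downarrow[x^{\downarrow\uparrow}]]]$. -}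

module Defs where

open import Level using (0ℓ)
open import Relation.Unary using (Pred; _⊆_; _≐_; ｛_｝)
open import Relation.Binary.PropositionalEquality using (_≡_)
open import Data.Product using (_×_)

Rel₂ : Set → Set → Set₁
Rel₂ A X = A → X → Set

module _ {A X : Set} where

  up : Rel₂ A X → Pred A 0ℓ → Pred X 0ℓ
  up S B x = ∀ a → B a → S a x

  down : Rel₂ A X → Pred X 0ℓ → Pred A 0ℓ
  down S Y a = ∀ x → Y x → S a x

  StableA : Rel₂ A X → Pred A 0ℓ → Set
  StableA I B = B ≐ down I (up I B)

  StableX : Rel₂ A X → Pred X 0ℓ → Set
  StableX I Y = Y ≐ up I (down I Y)

  Compatible : Rel₂ A X → Rel₂ A X → Set
  Compatible I R = (∀ x → StableA I (down R ｛ x ｝)) × (∀ a → StableX I (up R ｛ a ｝))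

  IProduct : Rel₂ A X → Rel₂ A X → Rel₂ A X → Rel₂ A X
  IProduct I Rs Rt a x = down Rs (up I (down Rt (up I (down I ｛ x ｝)))) a

module Submission where

-- Write B↑ = I↑[B], Y↓ = I↓[Y].  For any B ⊆ A the set
-- R_s↓[B↑] consists of those a whose "polar" R_s↑[a]↓ lies in B↑↓; the
-- inclusion one way holds always, the other way once R_s↑[a] is Galois-stable.
-- Hence, for I-compatible R_s, R_t and x ∈ Y:
--   a ∈ R_s↓[R_t↓[x↓↑]↑]  ⟺  a ∈ R_s↓[R_t↓[x]↑]  ⟺  R_s↑[a]↓ ⊆ R_t↓[x],
-- using that R_t↓[x] is stable and x ∈ x↓↑ ⊆ Y.  Intersecting over x ∈ Y gives
-- R_s↑[a]↓ ⊆ R_t↓[Y], i.e. a ∈ R_s↓[R_t↓[Y]↑].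

open import Defs
open import Relation.Unary using (Pred; _⊆_; _≐_; ｛_｝)
open import Relation.Binary.PropositionalEquality using (refl)
open import Data.Product using (_,_; proj₁; proj₂)

module _ {A X : Set} where

  down-antitone : (R : Rel₂ A X) {Y Y′ : Pred X _} → Y ⊆ Y′ → down R Y′ ⊆ down R Y
  down-antitone R Y⊆Y′ a∈ x x∈Y = a∈ x (Y⊆Y′ x∈Y)

  up-antitone : (R : Rel₂ A X) {B B′ : Pred A _} → B ⊆ B′ → up R B′ ⊆ up R B
  up-antitone R B⊆B′ x∈ a a∈B = x∈ a (B⊆B′ a∈B)

  downUp-monotone : (I R : Rel₂ A X) {B B′ : Pred A _} →
    B ⊆ B′ → down R (up I B) ⊆ down R (up I B′)
  downUp-monotone I R B⊆B′ = down-antitone R (up-antitone I B⊆B′)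

  point-in-closure : (I : Rel₂ A X) (x : X) → up I (down I ｛ x ｝) x
  point-in-closure I x a a∈x↓ = a∈x↓ x refl

  closure-of-point-⊆-stable : (I : Rel₂ A X) {Y : Pred X _} → StableX I Y →
    ∀ {x} → Y x → up I (down I ｛ x ｝) ⊆ Y
  closure-of-point-⊆-stable I stY x∈Y z∈x↓↑ =
    proj₂ stY (up-antitone I (down-antitone I (λ { refl → x∈Y })) z∈x↓↑)

  downUp⇒polar : (I R : Rel₂ A X) (B : Pred A _) {a : A} →
    down R (up I B) a → down I (up R ｛ a ｝) ⊆ down I (up I B)
  downUp⇒polar I R B a∈ b∈ z z∈B↑ = b∈ z (λ { _ refl → a∈ z z∈B↑ })

  polar⇒downUp : (I R : Rel₂ A X) {B : Pred A _} {a : A} →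
    StableX I (up R ｛ a ｝) → down I (up R ｛ a ｝) ⊆ B → down R (up I B) a
  polar⇒downUp I R stRa polar⊆B z z∈B↑ =
    proj₂ stRa (λ b b∈polar → z∈B↑ b (polar⊆B b∈polar)) _ refl

lemmaA9 : {A X : Set} (I Rs Rt : Rel₂ A X) →
    Compatible I Rs → Compatible I Rt →
    (Y : Pred X _) → StableX I Y →
    down (IProduct I Rs Rt) Y ≐ down Rs (up I (down Rt Y))
lemmaA9 I Rs Rt (_ , Rs↑-stable) (Rt↓-stable , _) Y stY = to , from
  where
  to : down (IProduct I Rs Rt) Y ⊆ down Rs (up I (down Rt Y))
  to {a} a∈ = polar⇒downUp I Rs (Rs↑-stable a) polar⊆Rt↓Y
    where
    polar⊆Rt↓Y : down I (up Rs ｛ a ｝) ⊆ down Rt Y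
    polar⊆Rt↓Y b∈polar x x∈Y =
      proj₂ (Rt↓-stable x) (downUp⇒polar I Rs (down Rt ｛ x ｝) a∈x b∈polar) x refl
      where
      a∈x : down Rs (up I (down Rt ｛ x ｝)) a
      a∈x = downUp-monotone I Rs
              (down-antitone Rt (λ { refl → point-in-closure I x })) (a∈ x x∈Y)

  -- x↓↑ ⊆ Y gives R_t↓[Y] ⊆ R_t↓[x↓↑], and R_s↓[(-)↑] is monotone.
  from : down Rs (up I (down Rt Y)) ⊆ down (IProduct I Rs Rt) Y
  from a∈ x x∈Y = downUp-monotone I Rs
    (down-antitone Rt (closure-of-point-⊆-stable I stY x∈Y)) a∈
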